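{- Let $(m_n)_{n\ge0}$ be the Mephisto Waltz sequence, where $m_n$ is the number of digits $2$ in the base-$3$ representation of $n$, taken modulo $2$. Then the running sum $\mathrm{sum}_{\mathrm{mw}}(n)=\sum_{i=0}^{n} m_i$ is not $3$-synchronised.
   Context: A function $f:\mathbb{N}\to\mathbb{N}$ is $3$-synchronised if there is a finite automaton which, reading the base-$3$ representations of $n$ and $m$ in parallel (most significant digit first, the shorter padded with leading zeros), accepts exactly the pairs $(n,m)$ with $m = f(n)$. -}

module Defs where

open import Data.Nat using (ℕ; zero; suc; _+_; _∸_; _⊔_; NonZero)
open import Data.Nat.DivMod using (_/_; _%_)
open import Data.Fin using (Fin; fromℕ<)
open import Data.Nat.DivMod using (m%n<n)
open import Data.List using (List; []; _∷_; _++_; length; replicate; foldl; zipWith)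
open import Data.Product using (_×_; _,_)
open import Data.Bool using (Bool; true)
open import Relation.Binary.PropositionalEquality using (_≡_)
open import Relation.Nullary using (¬_)

-- base-3 digits of n, least significant first; 0 has the empty representation
digitsFuel : ℕ → ℕ → List (Fin 3)
digitsFuel zero    n       = []
digitsFuel (suc k) zero    = []
digitsFuel (suc k) (suc n) = fromℕ< (m%n<n (suc n) 3) ∷ digitsFuel k (suc n / 3)

-- fuel n suffices since the number of base-3 digits of n is at most n
digitsLSD : ℕ → List (Fin 3)
digitsLSD n = digitsFuel n n

reverse : {A : Set} → List A → List A
reverse = foldl (λ acc x → x ∷ acc) []

base3 : ℕ → List (Fin 3)
base3 n = reverse (digitsLSD n)

padTo : ℕ → List (Fin 3) → List (Fin 3)
padTo k w = replicate (k ∸ length w) Data.Fin.zero ++ w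

pairRep : ℕ → ℕ → List (Fin 3 × Fin 3)
pairRep n m = zipWith _,_ (padTo L (base3 n)) (padTo L (base3 m))
  where L = length (base3 n) ⊔ length (base3 m)

record DFA (Σ : Set) : Set where
  field
    states : ℕ
    start  : Fin states
    δ      : Fin states → Σ → Fin states
    accept : Fin states → Bool

run : {Σ : Set} (A : DFA Σ) → Fin (DFA.states A) → List Σ → Fin (DFA.states A)
run A q []       = q
run A q (a ∷ w)  = run A (DFA.δ A q a) w

accepts : {Σ : Set} → DFA Σ → List Σ → Set
accepts A w = DFA.accept A (run A (DFA.start A) w) ≡ true

Synchronised3 : (ℕ → ℕ) → Set
Synchronised3 f = Data.Product.Σ (DFA (Fin 3 × Fin 3)) λ A →
  (n m : ℕ) → (accepts A (pairRep n m) → m ≡ f n) × (m ≡ f n → accepts A (pairRep n m))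

count2 : List (Fin 3) → ℕ
count2 [] = 0
count2 (Fin.suc (Fin.suc Fin.zero) ∷ w) = suc (count2 w)
count2 (_ ∷ w) = count2 w

mephisto : ℕ → ℕ
mephisto n = count2 (base3 n) % 2

sumMW : ℕ → ℕ
sumMW zero    = mephisto 0
sumMW (suc n) = sumMW n + mephisto (suc n)

_ : base3 13 ≡ Fin.suc Fin.zero ∷ Fin.suc Fin.zero ∷ Fin.suc Fin.zero ∷ []
_ = Relation.Binary.PropositionalEquality.refl
_ : Data.List.map mephisto (0 ∷ 1 ∷ 2 ∷ 3 ∷ 4 ∷ 5 ∷ 6 ∷ 7 ∷ 8 ∷ []) ≡ 0 ∷ 0 ∷ 1 ∷ 0 ∷ 0 ∷ 1 ∷ 1 ∷ 1 ∷ 0 ∷ []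
_ = Relation.Binary.PropositionalEquality.refl

{-# OPTIONS --safe #-}
module Submission where

-- Suppose an automaton with s states synchronises sumMW.  Since sumMW (3n) = n + sumMW n
-- and the Mephisto Waltz vanishes on repunits, the repunit u_k = 1^(2k+1) (base 3)
-- satisfies sumMW (u_k · 3^s) = v_k · 3^s + R_s − k, where u_k = 2 v_k + 1 and
-- R_s = 1^s.  Reading most significant digits first, the automaton sees the high part
-- (u_k , v_k) before the s low digits (0^s , R_s − k), and the latter determine k.
-- Among k = 0, …, s two values k < k′ leave the automaton in the same state after the
-- high part, so it accepts the high part for k′ followed by the low part for k, a pair
-- (u_k′ · 3^s , v_k′ · 3^s + R_s − k) which is not on the graph of sumMW.

open import Defs
open import Data.Empty using (⊥)
open import Data.Nat using (ℕ; zero; suc; _+_; _*_; _∸_; _^_; _⊔_; _≤_; _<_; z≤n; s≤s)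
open import Data.Nat.Properties
open import Data.Nat.DivMod
open import Data.Nat.Divisibility using (n∣m*n)
open import Data.Nat.Tactic.RingSolver using (solve-∀)
open import Data.Digit using (fromDigits)
open import Data.Fin as F using (Fin; toℕ; fromℕ<)
import Data.Fin.Properties as FP
open import Data.List using (List; []; _∷_; _++_; _∷ʳ_; length; replicate; zipWith)
import Data.List.Properties as LP
open import Data.Product using (_×_; _,_; proj₁; proj₂; ∃-syntax)
open import Function.Base using (_∘_)
open import Function.Bundles using (_⇔_; mk⇔; Equivalence)
open import Relation.Nullary using (¬_; contradiction)
open import Relation.Binary.PropositionalEquality

pattern one = F.suc F.zero
pattern two = F.suc (F.suc F.zero)

digitsFuel-zero : ∀ k → digitsFuel k 0 ≡ []
digitsFuel-zero zero    = refl
digitsFuel-zero (suc k) = refl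

suc/3≤ : ∀ n → suc n / 3 ≤ n
suc/3≤ n = ≤-pred (m/n<m (suc n) 3 (s≤s (s≤s z≤n)))

digitsFuel-irrelevant : ∀ {n} k k′ → n ≤ k → n ≤ k′ → digitsFuel k n ≡ digitsFuel k′ n
digitsFuel-irrelevant {zero}  k       k′       _          _           =
  trans (digitsFuel-zero k) (sym (digitsFuel-zero k′))
digitsFuel-irrelevant {suc n} (suc k) (suc k′) (s≤s n≤k) (s≤s n≤k′) =
  cong (_ ∷_) (digitsFuel-irrelevant k k′ (≤-trans (suc/3≤ n) n≤k) (≤-trans (suc/3≤ n) n≤k′))

digitsLSD-pos : ∀ {n} → 0 < n → digitsLSD n ≡ fromℕ< (m%n<n n 3) ∷ digitsLSD (n / 3)
digitsLSD-pos {suc n} _ =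
  cong (fromℕ< (m%n<n (suc n) 3) ∷_) (digitsFuel-irrelevant n (suc n / 3) (suc/3≤ n) ≤-refl)

[d+a*3]%3≡d : ∀ (d : Fin 3) a → (toℕ d + a * 3) % 3 ≡ toℕ d
[d+a*3]%3≡d d a = trans ([m+kn]%n≡m%n (toℕ d) a 3) (m<n⇒m%n≡m (FP.toℕ<n d))

[d+a*3]/3≡a : ∀ (d : Fin 3) a → (toℕ d + a * 3) / 3 ≡ a
[d+a*3]/3≡a d a = begin
  (toℕ d + a * 3) / 3    ≡⟨ +-distrib-/-∣ʳ (toℕ d) (n∣m*n a) ⟩
  toℕ d / 3 + a * 3 / 3  ≡⟨ cong₂ _+_ (m<n⇒m/n≡0 (FP.toℕ<n d)) (m*n/n≡m a 3) ⟩
  a                      ∎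
  where open ≡-Reasoning

digitsLSD-digit : ∀ (d : Fin 3) a → 0 < toℕ d + a * 3 →
                  digitsLSD (toℕ d + a * 3) ≡ d ∷ digitsLSD a
digitsLSD-digit d a pos =
  trans (digitsLSD-pos pos) (cong₂ _∷_ lowDigit (cong digitsLSD ([d+a*3]/3≡a d a)))
  where
  lowDigit : fromℕ< (m%n<n (toℕ d + a * 3) 3) ≡ d
  lowDigit = trans (FP.fromℕ<-cong _ _ ([d+a*3]%3≡d d a) _ (FP.toℕ<n d)) (FP.fromℕ<-toℕ d _)

base3-digit : ∀ (d : Fin 3) a → 0 < toℕ d + a * 3 → base3 (toℕ d + a * 3) ≡ base3 a ∷ʳ d
base3-digit d a pos =
  trans (cong reverse (digitsLSD-digit d a pos)) (LP.unfold-reverse d (digitsLSD a))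

replicate-∷ʳ : ∀ {A : Set} n (x : A) → replicate n x ∷ʳ x ≡ replicate (suc n) x
replicate-∷ʳ zero    x = refl
replicate-∷ʳ (suc n) x = cong (x ∷_) (replicate-∷ʳ n x)

reverse-∷-padded : ∀ {A : Set} (d : A) w x {z : A} t → reverse w ≡ replicate t z ++ x →
                   reverse (d ∷ w) ≡ replicate t z ++ (x ∷ʳ d)
reverse-∷-padded d w x {z} t eq =
  trans (LP.unfold-reverse d w) (trans (cong (_∷ʳ d) eq) (LP.++-assoc (replicate t z) x (d ∷ [])))

base3-cons : ∀ (d : Fin 3) w {v} t → reverse w ≡ replicate t F.zero ++ base3 v →
             ∃[ t′ ] reverse (d ∷ w) ≡ replicate t′ F.zero ++ base3 (toℕ d + v * 3)
base3-cons F.zero w {zero} t eq =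
  suc t , trans (reverse-∷-padded F.zero w [] t eq)
                (trans (replicate-∷ʳ t F.zero) (sym (LP.++-identityʳ _)))
base3-cons F.zero w {suc v} t eq =
  t , trans (reverse-∷-padded F.zero w _ t eq)
            (cong (replicate t F.zero ++_) (sym (base3-digit F.zero (suc v) (s≤s z≤n))))
base3-cons d@(F.suc _) w {v} t eq =
  t , trans (reverse-∷-padded d w _ t eq)
            (cong (replicate t F.zero ++_) (sym (base3-digit d v (s≤s z≤n))))

base3-fromDigits : ∀ (w : List (Fin 3)) →
                   ∃[ t ] reverse w ≡ replicate t F.zero ++ base3 (fromDigits w)
base3-fromDigits []      = 0 , refl
base3-fromDigits (d ∷ w) with base3-fromDigits w
... | t , eq = base3-cons d w {fromDigits w} t eq

base3-canonical : ∀ w (d : Fin 2) → base3 (fromDigits (w ∷ʳ F.suc d)) ≡ reverse (w ∷ʳ F.suc d)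
base3-canonical w d with base3-fromDigits (w ∷ʳ F.suc d)
... | zero  , eq = sym eq
... | suc t , eq =
  contradiction (LP.∷-injectiveˡ (trans (sym (LP.reverse-++ w (F.suc d ∷ []))) eq))
                (FP.0≢1+n ∘ sym)

padTo-length : ∀ x → padTo (length x) x ≡ x
padTo-length x = cong (λ k → replicate k F.zero ++ x) (n∸n≡0 (length x))

padTo-+ : ∀ t x → padTo (t + length x) x ≡ replicate t F.zero ++ x
padTo-+ t x = cong (λ k → replicate k F.zero ++ x) (m+n∸n≡m t (length x))

pairRep-leadingZeros : ∀ n m t → length (base3 n) ≡ t + length (base3 m) →
                       pairRep n m ≡ zipWith _,_ (base3 n) (replicate t F.zero ++ base3 m)
pairRep-leadingZeros n m t len = begin
  pairRep n m
    ≡⟨ cong (λ L → zipWith _,_ (padTo L (base3 n)) (padTo L (base3 m))) width ⟩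
  zipWith _,_ (padTo (length (base3 n)) (base3 n)) (padTo (length (base3 n)) (base3 m))
    ≡⟨ cong₂ (zipWith _,_) (padTo-length (base3 n))
                           (trans (cong (λ L → padTo L (base3 m)) len) (padTo-+ t (base3 m))) ⟩
  zipWith _,_ (base3 n) (replicate t F.zero ++ base3 m)
    ∎
  where
  open ≡-Reasoning
  width : length (base3 n) ⊔ length (base3 m) ≡ length (base3 n)
  width = m≥n⇒m⊔n≡m (≤-trans (m≤n+m _ t) (≤-reflexive (sym len)))

-- Digit lists are least significant digit first, as for fromDigits; the automaton reads
-- them reversed.
msdPairs : List (Fin 3) → List (Fin 3) → List (Fin 3 × Fin 3)
msdPairs w b = zipWith _,_ (reverse w) (reverse b)

pairRep-fromDigits : ∀ w b → base3 (fromDigits w) ≡ reverse w → length b ≡ length w →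
                     pairRep (fromDigits w) (fromDigits b) ≡ msdPairs w b
pairRep-fromDigits w b canonical len with base3-fromDigits b
... | t , eq = trans (pairRep-leadingZeros (fromDigits w) (fromDigits b) t lengths)
                     (cong₂ (zipWith _,_) canonical (sym eq))
  where
  open ≡-Reasoning
  lengths : length (base3 (fromDigits w)) ≡ t + length (base3 (fromDigits b))
  lengths = begin
    length (base3 (fromDigits w))                          ≡⟨ cong length canonical ⟩
    length (reverse w)                                     ≡⟨ LP.length-reverse w ⟩
    length w                                               ≡⟨ sym len ⟩
    length b                                               ≡⟨ sym (LP.length-reverse b) ⟩
    length (reverse b)                                     ≡⟨ cong length eq ⟩
    length (replicate t F.zero ++ base3 (fromDigits b))    ≡⟨ LP.length-++ (replicate t F.zero) ⟩
    length (replicate t F.zero) + length (base3 (fromDigits b))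
      ≡⟨ cong (_+ length (base3 (fromDigits b))) (LP.length-replicate t) ⟩
    t + length (base3 (fromDigits b))                      ∎

zipWith-++ : ∀ {A B C : Set} (f : A → B → C) xs ys {xs′ ys′} → length xs ≡ length ys →
             zipWith f (xs ++ xs′) (ys ++ ys′) ≡ zipWith f xs ys ++ zipWith f xs′ ys′
zipWith-++ f []       []       _   = refl
zipWith-++ f (x ∷ xs) (y ∷ ys) len = cong (f x y ∷_) (zipWith-++ f xs ys (suc-injective len))

msdPairs-++ : ∀ xs ys {xs′ ys′} → length xs′ ≡ length ys′ →
              msdPairs (xs ++ xs′) (ys ++ ys′) ≡ msdPairs xs′ ys′ ++ msdPairs xs ys
msdPairs-++ xs ys {xs′} {ys′} len = begin
  zipWith _,_ (reverse (xs ++ xs′)) (reverse (ys ++ ys′))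
    ≡⟨ cong₂ (zipWith _,_) (LP.reverse-++ xs xs′) (LP.reverse-++ ys ys′) ⟩
  zipWith _,_ (reverse xs′ ++ reverse xs) (reverse ys′ ++ reverse ys)
    ≡⟨ zipWith-++ _,_ (reverse xs′) (reverse ys′)
         (trans (LP.length-reverse xs′) (trans len (sym (LP.length-reverse ys′)))) ⟩
  msdPairs xs′ ys′ ++ msdPairs xs ys
    ∎
  where open ≡-Reasoning

fromDigits-++ : ∀ (xs ys : List (Fin 3)) →
                fromDigits (xs ++ ys) ≡ fromDigits xs + fromDigits ys * 3 ^ length xs
fromDigits-++ []       ys = sym (*-identityʳ (fromDigits ys))
fromDigits-++ (d ∷ xs) ys = trans (cong (λ v → toℕ d + v * 3) (fromDigits-++ xs ys))
                                  (shift (toℕ d) (fromDigits xs) (fromDigits ys) (3 ^ length xs))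
  where
  shift : ∀ d x y p → d + (x + y * p) * 3 ≡ (d + x * 3) + y * (3 * p)
  shift = solve-∀

fromDigits-zeros : ∀ t → fromDigits (replicate t (F.zero {2})) ≡ 0
fromDigits-zeros zero    = refl
fromDigits-zeros (suc t) = cong (_* 3) (fromDigits-zeros t)

fixedDigits : ℕ → ℕ → List (Fin 3)
fixedDigits zero    n = []
fixedDigits (suc L) n = fromℕ< (m%n<n n 3) ∷ fixedDigits L (n / 3)

length-fixedDigits : ∀ L n → length (fixedDigits L n) ≡ L
length-fixedDigits zero    n = refl
length-fixedDigits (suc L) n = cong suc (length-fixedDigits L (n / 3))

fromDigits-fixedDigits : ∀ L {n} → n < 3 ^ L → fromDigits (fixedDigits L n) ≡ n
fromDigits-fixedDigits zero    {zero}  _         = refl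
fromDigits-fixedDigits zero    {suc n} (s≤s ())
fromDigits-fixedDigits (suc L) {n}     n<3^L+1 =
  trans (cong₂ _+_ (FP.toℕ-fromℕ< _) (cong (_* 3) (fromDigits-fixedDigits L n/3<3^L)))
        (sym (m≡m%n+[m/n]*n n 3))
  where
  n/3<3^L : n / 3 < 3 ^ L
  n/3<3^L = m<n*o⇒m/o<n (subst (n <_) (*-comm 3 (3 ^ L)) n<3^L+1)

count2-++ : ∀ xs ys → count2 (xs ++ ys) ≡ count2 xs + count2 ys
count2-++ []            ys = refl
count2-++ (F.zero ∷ xs) ys = count2-++ xs ys
count2-++ (one ∷ xs)    ys = count2-++ xs ys
count2-++ (two ∷ xs)    ys = cong suc (count2-++ xs ys)

mephisto-digit : ∀ (d : Fin 3) a → 0 < toℕ d + a * 3 →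
                 mephisto (toℕ d + a * 3) ≡ (count2 (base3 a) + count2 (d ∷ [])) % 2
mephisto-digit d a pos = trans (cong (λ w → count2 w % 2) (base3-digit d a pos))
                               (cong (_% 2) (count2-++ (base3 a) (d ∷ [])))

mephisto-*3 : ∀ a → mephisto (a * 3) ≡ mephisto a
mephisto-*3 zero      = refl
mephisto-*3 a@(suc _) =
  trans (mephisto-digit F.zero a (s≤s z≤n)) (cong (_% 2) (+-identityʳ (count2 (base3 a))))

mephisto-1+*3 : ∀ a → mephisto (1 + a * 3) ≡ mephisto a
mephisto-1+*3 a = trans (mephisto-digit one a (s≤s z≤n)) (cong (_% 2) (+-identityʳ (count2 (base3 a))))

mephisto-2+*3 : ∀ a → mephisto (2 + a * 3) + mephisto a ≡ 1
mephisto-2+*3 a = trans (cong (_+ mephisto a) (mephisto-digit two a (s≤s z≤n)))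
                        (parity (count2 (base3 a)))
  where
  parity : ∀ c → (c + 1) % 2 + c % 2 ≡ 1
  parity zero          = refl
  parity (suc zero)    = refl
  parity (suc (suc c)) = parity c

sumMW-*3 : ∀ n → sumMW (n * 3) ≡ n + sumMW n
sumMW-*3 zero    = refl
sumMW-*3 (suc n) = begin
  sumMW (n * 3) + mephisto (1 + n * 3) + mephisto (2 + n * 3) + mephisto (suc n * 3)
    ≡⟨ cong₂ _+_ (cong (_+ mephisto (2 + n * 3)) (cong₂ _+_ (sumMW-*3 n) (mephisto-1+*3 n)))
                 (mephisto-*3 (suc n)) ⟩
  n + sumMW n + mephisto n + mephisto (2 + n * 3) + mephisto (suc n)
    ≡⟨ regroup n (sumMW n) (mephisto n) (mephisto (2 + n * 3)) (mephisto (suc n)) ⟩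
  n + (mephisto (2 + n * 3) + mephisto n) + sumMW (suc n)
    ≡⟨ cong (λ c → n + c + sumMW (suc n)) (mephisto-2+*3 n) ⟩
  n + 1 + sumMW (suc n)
    ≡⟨ cong (_+ sumMW (suc n)) (+-comm n 1) ⟩
  suc n + sumMW (suc n)
    ∎
  where
  open ≡-Reasoning
  regroup : ∀ n s x y z → n + s + x + y + z ≡ n + (y + x) + (s + z)
  regroup = solve-∀

repunit : ℕ → ℕ
repunit j = fromDigits {3} (replicate j one)

mephisto-repunit : ∀ j → mephisto (repunit j) ≡ 0
mephisto-repunit zero    = refl
mephisto-repunit (suc j) = trans (mephisto-1+*3 (repunit j)) (mephisto-repunit j)

sumMW-repunit : ∀ j → sumMW (repunit j) * 2 + j ≡ repunit j
sumMW-repunit zero    = refl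
sumMW-repunit (suc j) = begin
  (sumMW (r * 3) + mephisto (1 + r * 3)) * 2 + suc j
    ≡⟨ cong (λ x → x * 2 + suc j)
            (cong₂ _+_ (sumMW-*3 r) (trans (mephisto-1+*3 r) (mephisto-repunit j))) ⟩
  (r + sumMW r + 0) * 2 + suc j    ≡⟨ regroup r (sumMW r) j ⟩
  r * 2 + suc (sumMW r * 2 + j)    ≡⟨ cong (λ x → r * 2 + suc x) (sumMW-repunit j) ⟩
  r * 2 + suc r                    ≡⟨ collect r ⟩
  1 + r * 3                        ∎
  where
  open ≡-Reasoning
  r = repunit j
  regroup : ∀ r s j → (r + s + 0) * 2 + suc j ≡ r * 2 + suc (s * 2 + j)
  regroup = solve-∀
  collect : ∀ r → r * 2 + suc r ≡ 1 + r * 3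
  collect = solve-∀

3^≡1+repunit*2 : ∀ j → 3 ^ j ≡ 1 + repunit j * 2
3^≡1+repunit*2 zero    = refl
3^≡1+repunit*2 (suc j) = trans (cong (3 *_) (3^≡1+repunit*2 j)) (expand (repunit j))
  where
  expand : ∀ r → 3 * (1 + r * 2) ≡ 1 + (1 + r * 3) * 2
  expand = solve-∀

sumMW-*3^ : ∀ n j → sumMW (n * 3 ^ j) ≡ n * repunit j + sumMW n
sumMW-*3^ n zero    = trans (cong sumMW (*-identityʳ n)) (cong (_+ sumMW n) (sym (*-zeroʳ n)))
sumMW-*3^ n (suc j) = begin
  sumMW (n * (3 * 3 ^ j))
    ≡⟨ cong sumMW (trans (cong (n *_) (*-comm 3 (3 ^ j))) (sym (*-assoc n (3 ^ j) 3))) ⟩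
  sumMW (n * 3 ^ j * 3)                ≡⟨ sumMW-*3 (n * 3 ^ j) ⟩
  n * 3 ^ j + sumMW (n * 3 ^ j)        ≡⟨ cong₂ _+_ (cong (n *_) (3^≡1+repunit*2 j)) (sumMW-*3^ n j) ⟩
  n * (1 + r * 2) + (n * r + sumMW n)  ≡⟨ regroup n r (sumMW n) ⟩
  n * (1 + r * 3) + sumMW n            ∎
  where
  open ≡-Reasoning
  r = repunit j
  regroup : ∀ n r s → n * (1 + r * 2) + (n * r + s) ≡ n * (1 + r * 3) + s
  regroup = solve-∀

repunit<3^ : ∀ j → repunit j < 3 ^ j
repunit<3^ j = subst (repunit j <_) (sym (3^≡1+repunit*2 j)) (s≤s (m≤m*n (repunit j) 2))

n≤repunit : ∀ j → j ≤ repunit j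
n≤repunit zero    = z≤n
n≤repunit (suc j) = s≤s (≤-trans (n≤repunit j) (m≤m*n (repunit j) 3))

oddRepunit : ℕ → ℕ
oddRepunit k = repunit (suc (k * 2))

-- This is (oddRepunit k ∸ 1) / 2, written in the form in which sumMW-repunit produces it.
half : ℕ → ℕ
half k = sumMW (oddRepunit k) + k

oddRepunit≡1+half*2 : ∀ k → oddRepunit k ≡ 1 + half k * 2
oddRepunit≡1+half*2 k = trans (sym (sumMW-repunit (suc (k * 2)))) (regroup (sumMW (oddRepunit k)) k)
  where
  regroup : ∀ s k → s * 2 + suc (k * 2) ≡ 1 + (s + k) * 2
  regroup = solve-∀

half<3^ : ∀ k → half k < 3 ^ suc (k * 2)
half<3^ k = begin-strict
  half k           <⟨ s≤s (m≤m*n (half k) 2) ⟩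
  1 + half k * 2   ≡⟨ sym (oddRepunit≡1+half*2 k) ⟩
  oddRepunit k     <⟨ repunit<3^ (suc (k * 2)) ⟩
  3 ^ suc (k * 2)  ∎
  where open ≤-Reasoning

sumMW-oddRepunit*3^ : ∀ k s → sumMW (oddRepunit k * 3 ^ s) + k ≡ half k * 3 ^ s + repunit s
sumMW-oddRepunit*3^ k s = begin
  sumMW (oddRepunit k * 3 ^ s) + k             ≡⟨ cong (_+ k) (sumMW-*3^ (oddRepunit k) s) ⟩
  oddRepunit k * r + sumMW (oddRepunit k) + k  ≡⟨ +-assoc (oddRepunit k * r) _ k ⟩
  oddRepunit k * r + half k                    ≡⟨ cong (λ u → u * r + half k) (oddRepunit≡1+half*2 k) ⟩
  (1 + half k * 2) * r + half k                ≡⟨ regroup (half k) r ⟩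
  half k * (1 + r * 2) + r                     ≡⟨ cong (λ p → half k * p + r) (sym (3^≡1+repunit*2 s)) ⟩
  half k * 3 ^ s + r                           ∎
  where
  open ≡-Reasoning
  r = repunit s
  regroup : ∀ v r → (1 + v * 2) * r + v ≡ v * (1 + r * 2) + r
  regroup = solve-∀

offset-cancel : ∀ {r a} c x k → a ≤ r → x + k ≡ c + r → ((r ∸ a) + c ≡ x) ⇔ (a ≡ k)
offset-cancel {r} {a} c x k a≤r x+k≡c+r = mk⇔ to from
  where
  restore : (r ∸ a) + c + a ≡ c + r
  restore = trans (regroup (r ∸ a) c a) (cong (c +_) (m∸n+n≡m a≤r))
    where
    regroup : ∀ y c a → y + c + a ≡ c + (y + a)
    regroup = solve-∀
  to : (r ∸ a) + c ≡ x → a ≡ k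
  to eq = +-cancelˡ-≡ x a k (trans (cong (_+ a) (sym eq)) (trans restore (sym x+k≡c+r)))
  from : a ≡ k → (r ∸ a) + c ≡ x
  from a≡k = +-cancelʳ-≡ a _ x (trans restore (trans (sym x+k≡c+r) (cong (x +_) (sym a≡k))))

highPairs : ℕ → List (Fin 3 × Fin 3)
highPairs k = msdPairs (replicate (suc (k * 2)) one) (fixedDigits (suc (k * 2)) (half k))

lowPairs : ℕ → ℕ → List (Fin 3 × Fin 3)
lowPairs s a = msdPairs (replicate s F.zero) (fixedDigits s (repunit s ∸ a))

argDigits : ℕ → ℕ → List (Fin 3)
argDigits s k = replicate s F.zero ++ replicate (suc (k * 2)) one

valDigits : ℕ → ℕ → ℕ → List (Fin 3)
valDigits s a k = fixedDigits s (repunit s ∸ a) ++ fixedDigits (suc (k * 2)) (half k)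

fromDigits-argDigits : ∀ s k → fromDigits (argDigits s k) ≡ oddRepunit k * 3 ^ s
fromDigits-argDigits s k =
  trans (fromDigits-++ (replicate s F.zero) (replicate (suc (k * 2)) one))
        (cong₂ (λ z L → z + oddRepunit k * 3 ^ L) (fromDigits-zeros s) (LP.length-replicate s))

fromDigits-valDigits : ∀ s a k → fromDigits (valDigits s a k) ≡ (repunit s ∸ a) + half k * 3 ^ s
fromDigits-valDigits s a k = begin
  fromDigits (low ++ high)                         ≡⟨ fromDigits-++ low high ⟩
  fromDigits low + fromDigits high * 3 ^ length low
    ≡⟨ cong₂ (λ x y → x + y * 3 ^ length low) (fromDigits-fixedDigits s low-fits)
                                               (fromDigits-fixedDigits (suc (k * 2)) (half<3^ k)) ⟩
  (repunit s ∸ a) + half k * 3 ^ length low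
    ≡⟨ cong (λ L → (repunit s ∸ a) + half k * 3 ^ L) (length-fixedDigits s (repunit s ∸ a)) ⟩
  (repunit s ∸ a) + half k * 3 ^ s                 ∎
  where
  open ≡-Reasoning
  low  = fixedDigits s (repunit s ∸ a)
  high = fixedDigits (suc (k * 2)) (half k)
  low-fits : repunit s ∸ a < 3 ^ s
  low-fits = ≤-<-trans (m∸n≤m (repunit s) a) (repunit<3^ s)

base3-argDigits : ∀ s k → base3 (fromDigits (argDigits s k)) ≡ reverse (argDigits s k)
base3-argDigits s k = subst (λ w → base3 (fromDigits w) ≡ reverse w) (sym asSnoc)
                            (base3-canonical (replicate s F.zero ++ replicate (k * 2) one) F.zero)
  where
  asSnoc : argDigits s k ≡ (replicate s F.zero ++ replicate (k * 2) one) ∷ʳ one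
  asSnoc = trans (cong (replicate s F.zero ++_) (sym (replicate-∷ʳ (k * 2) one)))
                 (sym (LP.++-assoc (replicate s F.zero) (replicate (k * 2) one) (one ∷ [])))

pairRep-witness : ∀ s a k →
  pairRep (fromDigits (argDigits s k)) (fromDigits (valDigits s a k)) ≡ highPairs k ++ lowPairs s a
pairRep-witness s a k =
  trans (pairRep-fromDigits (argDigits s k) (valDigits s a k) (base3-argDigits s k) lengths)
        (msdPairs-++ (replicate s F.zero) (fixedDigits s (repunit s ∸ a))
                     (trans (LP.length-replicate (suc (k * 2)))
                            (sym (length-fixedDigits (suc (k * 2)) (half k)))))
  where
  lengths : length (valDigits s a k) ≡ length (argDigits s k)
  lengths = begin
    length (valDigits s a k)
      ≡⟨ LP.length-++ (fixedDigits s (repunit s ∸ a)) ⟩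
    length (fixedDigits s (repunit s ∸ a)) + length (fixedDigits (suc (k * 2)) (half k))
      ≡⟨ cong₂ _+_ (length-fixedDigits s (repunit s ∸ a))
                   (length-fixedDigits (suc (k * 2)) (half k)) ⟩
    s + suc (k * 2)
      ≡⟨ sym (cong₂ _+_ (LP.length-replicate s) (LP.length-replicate (suc (k * 2)))) ⟩
    length (replicate s F.zero) + length (replicate (suc (k * 2)) one)
      ≡⟨ sym (LP.length-++ (replicate s F.zero)) ⟩
    length (argDigits s k)
      ∎
    where open ≡-Reasoning

witness-correct : ∀ s {a k} → a ≤ repunit s →
  (fromDigits (valDigits s a k) ≡ sumMW (fromDigits (argDigits s k))) ⇔ (a ≡ k)
witness-correct s {a} {k} a≤ =
  subst₂ (λ m n → (m ≡ sumMW n) ⇔ (a ≡ k))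
         (sym (fromDigits-valDigits s a k)) (sym (fromDigits-argDigits s k))
         (offset-cancel (half k * 3 ^ s) (sumMW (oddRepunit k * 3 ^ s)) k a≤
                        (sumMW-oddRepunit*3^ k s))

run-++ : ∀ {Σ : Set} (D : DFA Σ) q xs ys → run D q (xs ++ ys) ≡ run D (run D q xs) ys
run-++ D q []       ys = refl
run-++ D q (x ∷ xs) ys = run-++ D (DFA.δ D q x) xs ys

no-fooling-set : ∀ {Σ : Set} (D : DFA Σ) (pre suf : Fin (suc (DFA.states D)) → List Σ) →
                 (∀ i → accepts D (pre i ++ suf i)) →
                 (∀ i j → accepts D (pre j ++ suf i) → i ≡ j) → ⊥
no-fooling-set D pre suf diagonal offDiagonal
  with FP.pigeonhole (n<1+n (DFA.states D)) (λ i → run D (DFA.start D) (pre i))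
... | i , j , i<j , sameState = FP.<-irrefl (offDiagonal i j confused) i<j
  where
  open ≡-Reasoning
  q₀ = DFA.start D
  confused : accepts D (pre j ++ suf i)
  confused = trans (cong (DFA.accept D) (begin
    run D q₀ (pre j ++ suf i)       ≡⟨ run-++ D q₀ (pre j) (suf i) ⟩
    run D (run D q₀ (pre j)) (suf i) ≡⟨ cong (λ q → run D q (suf i)) (sym sameState) ⟩
    run D (run D q₀ (pre i)) (suf i) ≡⟨ sym (run-++ D q₀ (pre i) (suf i)) ⟩
    run D q₀ (pre i ++ suf i)       ∎)) (diagonal i)

mainTheorem5 : ¬ Synchronised3 sumMW
mainTheorem5 (D , graph) =
  no-fooling-set D (highPairs ∘ toℕ) (lowPairs s ∘ toℕ) diagonal offDiagonal
  where
  s = DFA.states D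
  arg : ℕ → ℕ
  arg k = fromDigits (argDigits s k)
  val : ℕ → ℕ → ℕ
  val a k = fromDigits (valDigits s a k)
  correct : (i : Fin (suc s)) {k : ℕ} → (val (toℕ i) k ≡ sumMW (arg k)) ⇔ (toℕ i ≡ k)
  correct i = witness-correct s (≤-trans (FP.toℕ≤pred[n] i) (n≤repunit s))
  diagonal : ∀ i → accepts D (highPairs (toℕ i) ++ lowPairs s (toℕ i))
  diagonal i = subst (accepts D) (pairRep-witness s (toℕ i) (toℕ i))
                     (proj₂ (graph (arg (toℕ i)) (val (toℕ i) (toℕ i)))
                            (Equivalence.from (correct i) refl))
  offDiagonal : ∀ i j → accepts D (highPairs (toℕ j) ++ lowPairs s (toℕ i)) → i ≡ j
  offDiagonal i j accepted = FP.toℕ-injective (Equivalence.to (correct i)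
    (proj₁ (graph (arg (toℕ j)) (val (toℕ i) (toℕ j)))
           (subst (accepts D) (sym (pairRep-witness s (toℕ i) (toℕ j))) accepted)))
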